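{- Let $G$ be a bipartite graph with partition classes $A$ and $B$, and let $v$ be a vertex in $B$. If all vertices in $A$ have even degree and all vertices in $B\setminus \{v\}$ have odd degree, then there exists a path $P$ in $G$ starting in $v$ (possibly of length $0$) such that $G-E(P)$ is locally irregular.
   Context: All graphs are finite and simple. A graph is locally irregular if any two adjacent vertices have distinct degrees. -}

module Defs where

open import Data.Nat using (ℕ; zero; suc; _+_; _%_)
open import Data.Bool using (Bool; true; false; _∧_; _∨_; not; if_then_else_)
open import Data.Fin using (Fin; zero; suc; _≟_)
open import Data.List using (List; []; _∷_)
open import Data.List.Relation.Unary.Linked using (Linked)
open import Data.List.Relation.Unary.Unique.Propositional using (Unique)
open import Relation.Binary.PropositionalEquality using (_≡_; _≢_)
open import Relation.Nullary.Decidable using (⌊_⌋)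

record Graph (n : ℕ) : Set where
  field
    adj    : Fin n → Fin n → Bool
    sym    : ∀ x y → adj x y ≡ adj y x
    irrefl : ∀ x → adj x x ≡ false
open Graph public

countTrue : (k : ℕ) → (Fin k → Bool) → ℕ
countTrue zero    f = 0
countTrue (suc k) f = (if f zero then 1 else 0) + countTrue k (λ i → f (suc i))

degree : ∀ {n} → Graph n → Fin n → ℕ
degree {n} G x = countTrue n (adj G x)

Adjacent : ∀ {n} → Graph n → Fin n → Fin n → Set
Adjacent G x y = adj G x y ≡ true

-- G is bipartite with partition classes A = {x | side x ≡ false}, B = {x | side x ≡ true}
IsBipartition : ∀ {n} → Graph n → (Fin n → Bool) → Set
IsBipartition G side = ∀ x y → Adjacent G x y → side x ≢ side y

Even Odd : ℕ → Set
Even m = m % 2 ≡ 0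
Odd  m = m % 2 ≡ 1

-- A path in G starting at v, given by its vertex sequence v = p₀, p₁, …, pₖ:
-- distinct vertices, consecutive ones adjacent. [ v ] is the path of length 0.
IsPathFrom : ∀ {n} → Graph n → Fin n → List (Fin n) → Set
IsPathFrom G v []      = Data.Empty.⊥
  where import Data.Empty
IsPathFrom G v (p ∷ ps) =
  (p ≡ v) Data.Product.× (Linked (Adjacent G) (p ∷ ps) Data.Product.× Unique (p ∷ ps))
  where import Data.Product

inPathEdges : ∀ {n} → List (Fin n) → Fin n → Fin n → Bool
inPathEdges []             x y = false
inPathEdges (p ∷ [])       x y = false
inPathEdges (p ∷ q ∷ ps)   x y =
  (⌊ p ≟ x ⌋ ∧ ⌊ q ≟ y ⌋) ∨ (⌊ p ≟ y ⌋ ∧ ⌊ q ≟ x ⌋) ∨ inPathEdges (q ∷ ps) x y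

removeEdges : ∀ {n} → Graph n → List (Fin n) → Graph n
removeEdges G P = record
  { adj    = λ x y → adj G x y ∧ not (inPathEdges P x y)
  ; sym    = λ x y → symProof x y
  ; irrefl = λ x → irrProof x
  }
  where
    open import Relation.Binary.PropositionalEquality using (cong₂; refl)
    open import Data.Bool.Properties using (∨-comm; ∨-assoc)
    swap : ∀ (Q : List _) x y → inPathEdges Q x y ≡ inPathEdges Q y x
    swap []           x y = refl
    swap (p ∷ [])     x y = refl
    swap (p ∷ q ∷ ps) x y
      rewrite swap (q ∷ ps) x y
            | ∨-comm (⌊ p ≟ x ⌋ ∧ ⌊ q ≟ y ⌋) ((⌊ p ≟ y ⌋ ∧ ⌊ q ≟ x ⌋) ∨ inPathEdges (q ∷ ps) y x)
            | ∨-assoc (⌊ p ≟ y ⌋ ∧ ⌊ q ≟ x ⌋) (inPathEdges (q ∷ ps) y x) (⌊ p ≟ x ⌋ ∧ ⌊ q ≟ y ⌋)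
            | ∨-comm (inPathEdges (q ∷ ps) y x) (⌊ p ≟ x ⌋ ∧ ⌊ q ≟ y ⌋) = refl
    symProof : ∀ x y → (adj G x y ∧ not (inPathEdges P x y)) ≡ (adj G y x ∧ not (inPathEdges P y x))
    symProof x y = cong₂ (λ a b → a ∧ not b) (sym G x y) (swap P x y)
    irrProof : ∀ x → (adj G x x ∧ not (inPathEdges P x x)) ≡ false
    irrProof x rewrite irrefl G x = refl

LocallyIrregular : ∀ {n} → Graph n → Set
LocallyIrregular G = ∀ x y → Adjacent G x y → degree G x ≢ degree G y

-- Degree parities are the key invariant: in G they record the bipartition side at every vertex
-- except v, so adjacent vertices can only share a degree at v. If no neighbour of v has the
-- degree of v, the path of length 0 works. Otherwise start at such a neighbour p and walk
-- greedily to neighbours of degree one less, as long as possible; let P be v followed by this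
-- walk, ending at e. Removing E(P) lowers inner degrees by 2 and end degrees by 1, so parities
-- still record the sides everywhere except at e (v turns odd since deg v = deg p is even). A
-- neighbour w of e with the same new degree would lie off P (so the walk could continue), be v
-- (so deg e = deg p, the walk is trivial and ew ∈ E(P)), or lie on the walk one level above e
-- (so w precedes e and again ew ∈ E(P)).
module Submission where

open import Defs renaming (sym to adj-sym)
open import Data.Nat using (ℕ; zero; suc; _+_; _*_; _%_; _<_)
open import Data.Nat.Properties
  using ( suc-injective; +-comm; +-identityʳ; *-comm; *-distribˡ-+
        ; <-irrefl; <-trans; ≤-reflexive; 1+n≢n; +-commutativeSemigroup)
import Data.Nat as Nat
open import Data.Nat.DivMod using ([m+kn]%n≡m%n)
open import Data.Nat.Tactic.RingSolver using (solve-∀)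
open import Algebra.Properties.CommutativeSemigroup +-commutativeSemigroup
  using () renaming (interchange to +-interchange)
open import Data.Bool using (Bool; true; false; _∧_; _∨_; not; if_then_else_)
open import Data.Bool.Properties using (∨-zeroʳ; ∧-comm)
import Data.Bool.Properties as Bool
open import Data.Fin using (Fin; zero; suc; _≟_)
open import Data.Fin.Properties using (any?)
import Data.Fin.Properties as Fin
open import Data.List using (List; []; _∷_)
open import Data.List.Relation.Unary.Any using (here; there)
import Data.List.Relation.Unary.Any as Any
open import Data.List.Relation.Unary.All using (All; []; _∷_)
import Data.List.Relation.Unary.All as All
open import Data.List.Relation.Unary.All.Properties using (¬Any⇒All¬; All¬⇒¬Any)
open import Data.List.Relation.Unary.AllPairs using ([]; _∷_)
open import Data.List.Relation.Unary.Linked using (Linked; [-]; _∷_)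
open import Data.List.Relation.Unary.Unique.Propositional using (Unique)
open import Data.List.Membership.Propositional using (_∈_; _∉_)
import Data.Product as Product
open import Data.Product using (Σ; ∃; _×_; _,_; proj₁; proj₂)
open import Data.Sum using (_⊎_; inj₁; inj₂; [_,_]′)
open import Data.Empty using (⊥; ⊥-elim)
open import Function using (_∘_)
open import Relation.Nullary using (¬_; Dec; yes; no; _×-dec_)
open import Relation.Nullary.Decidable using (⌊_⌋; ⌊⌋-map′)
open import Relation.Binary.PropositionalEquality
  using (_≡_; _≢_; refl; sym; trans; cong; cong₂; subst; module ≡-Reasoning)

bit : Bool → ℕ
bit b = if b then 1 else 0

bit-injective : ∀ {a b} → bit a ≡ bit b → a ≡ b
bit-injective {false} {false} _ = refl
bit-injective {true}  {true}  _ = refl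

bit-∨ : ∀ a b → (a ≡ true → b ≡ true → ⊥) → bit (a ∨ b) ≡ bit a + bit b
bit-∨ false b     _        = refl
bit-∨ true  false _        = refl
bit-∨ true  true  disjoint = ⊥-elim (disjoint refl refl)

bit-∧-not : ∀ a b → (b ≡ true → a ≡ true) → bit a ≡ bit (a ∧ not b) + bit b
bit-∧-not false false _   = refl
bit-∧-not false true  b⇒a with () ← b⇒a refl
bit-∧-not true  false _   = refl
bit-∧-not true  true  _   = refl

∨-true⁻ : ∀ a {b} → a ∨ b ≡ true → a ≡ true ⊎ b ≡ true
∨-true⁻ true  _ = inj₁ refl
∨-true⁻ false e = inj₂ e

countTrue-cong : ∀ k {f g : Fin k → Bool} → (∀ i → f i ≡ g i) → countTrue k f ≡ countTrue k g
countTrue-cong zero    _   = refl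
countTrue-cong (suc k) f≗g = cong₂ _+_ (cong bit (f≗g zero)) (countTrue-cong k (f≗g ∘ suc))

countTrue-false : ∀ k → countTrue k (λ _ → false) ≡ 0
countTrue-false zero    = refl
countTrue-false (suc k) = countTrue-false k

countTrue-+ : ∀ k {f g h : Fin k → Bool} → (∀ i → bit (h i) ≡ bit (f i) + bit (g i)) →
              countTrue k h ≡ countTrue k f + countTrue k g
countTrue-+ zero    _  = refl
countTrue-+ (suc k) {f} {g} pointwise =
  trans (cong₂ _+_ (pointwise zero) (countTrue-+ k (pointwise ∘ suc)))
        (+-interchange (bit (f zero)) (bit (g zero)) _ _)

countTrue-∨ : ∀ k {f g : Fin k → Bool} → (∀ i → f i ≡ true → g i ≡ true → ⊥) →
              countTrue k (λ i → f i ∨ g i) ≡ countTrue k f + countTrue k g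
countTrue-∨ k {f} {g} disjoint = countTrue-+ k (λ i → bit-∨ (f i) (g i) (disjoint i))

countTrue-≟ : ∀ k (q : Fin k) → countTrue k (λ y → ⌊ q ≟ y ⌋) ≡ 1
countTrue-≟ (suc k) zero    = cong suc (countTrue-false k)
countTrue-≟ (suc k) (suc q) =
  trans (countTrue-cong k (λ i → ⌊⌋-map′ (cong suc) Fin.suc-injective (q ≟ i))) (countTrue-≟ k q)

countTrue-∧-≟ : ∀ k b (q : Fin k) → countTrue k (λ y → b ∧ ⌊ q ≟ y ⌋) ≡ bit b
countTrue-∧-≟ k false q = countTrue-false k
countTrue-∧-≟ k true  q = countTrue-≟ k q

lastOf : ∀ {A : Set} → A → List A → A
lastOf x []       = x
lastOf _ (y ∷ ys) = lastOf y ys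

lastOf-∈ : ∀ {A : Set} (x : A) xs → lastOf x xs ∈ x ∷ xs
lastOf-∈ x []       = here refl
lastOf-∈ x (y ∷ ys) = there (lastOf-∈ y ys)

module _ {n : ℕ} where

  ≟-refl : (a : Fin n) → ⌊ a ≟ a ⌋ ≡ true
  ≟-refl a with a ≟ a
  ... | yes _   = refl
  ... | no  a≢a = ⊥-elim (a≢a refl)

  ≟-≢ : {a b : Fin n} → a ≢ b → ⌊ a ≟ b ⌋ ≡ false
  ≟-≢ {a} {b} a≢b with a ≟ b
  ... | yes a≡b = ⊥-elim (a≢b a≡b)
  ... | no  _   = refl

  ≟∧≟-sound : {a b c d : Fin n} → ⌊ a ≟ b ⌋ ∧ ⌊ c ≟ d ⌋ ≡ true → a ≡ b × c ≡ d
  ≟∧≟-sound {a} {b} {c} {d} e with a ≟ b | c ≟ d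
  ... | yes a≡b | yes c≡d = a≡b , c≡d

  inPathEdges-∷⁻ : ∀ (p q : Fin n) ps {x y} → inPathEdges (p ∷ q ∷ ps) x y ≡ true →
    (p ≡ x × q ≡ y) ⊎ (p ≡ y × q ≡ x) ⊎ inPathEdges (q ∷ ps) x y ≡ true
  inPathEdges-∷⁻ p q ps {x} {y} e with ∨-true⁻ (⌊ p ≟ x ⌋ ∧ ⌊ q ≟ y ⌋) e
  ... | inj₁ forward = inj₁ (≟∧≟-sound forward)
  ... | inj₂ rest with ∨-true⁻ (⌊ p ≟ y ⌋ ∧ ⌊ q ≟ x ⌋) rest
  ...   | inj₁ backward = inj₂ (inj₁ (≟∧≟-sound backward))
  ...   | inj₂ later    = inj₂ (inj₂ later)

  inPathEdges-there : ∀ (p q : Fin n) ps {x y} → inPathEdges (q ∷ ps) x y ≡ true →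
                      inPathEdges (p ∷ q ∷ ps) x y ≡ true
  inPathEdges-there p q ps {x} {y} e rewrite e | ∨-zeroʳ (⌊ p ≟ y ⌋ ∧ ⌊ q ≟ x ⌋) = ∨-zeroʳ _

  inPathEdges-back : ∀ (p q : Fin n) ps → inPathEdges (p ∷ q ∷ ps) q p ≡ true
  inPathEdges-back p q ps rewrite ≟-refl p | ≟-refl q = ∨-zeroʳ _

  inPathEdges-∈ : ∀ L {x y : Fin n} → inPathEdges L x y ≡ true → x ∈ L × y ∈ L
  inPathEdges-∈ (p ∷ q ∷ ps) e =
    [ (λ { (refl , refl) → here refl , there (here refl) })
    , [ (λ { (refl , refl) → there (here refl) , here refl })
      , Product.map there there ∘ inPathEdges-∈ (q ∷ ps) ]′ ]′ (inPathEdges-∷⁻ p q ps e)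

  inPathEdges-adjacent : ∀ (G : Graph n) {L} {x y} → Linked (Adjacent G) L →
                         inPathEdges L x y ≡ true → Adjacent G x y
  inPathEdges-adjacent G {p ∷ q ∷ ps} {x} {y} (p~q ∷ linked) e with inPathEdges-∷⁻ p q ps e
  ... | inj₁ (refl , refl)        = p~q
  ... | inj₂ (inj₁ (refl , refl)) = trans (adj-sym G q p) p~q
  ... | inj₂ (inj₂ later)         = inPathEdges-adjacent G linked later

  [_≐_] : Fin n → Fin n → ℕ
  [ a ≐ b ] = bit ⌊ a ≟ b ⌋

  occurrences : List (Fin n) → Fin n → ℕ
  occurrences []       z = 0
  occurrences (p ∷ ps) z = [ p ≐ z ] + occurrences ps z

  pathDegree : List (Fin n) → Fin n → ℕ
  pathDegree (p ∷ q ∷ ps) z = [ p ≐ z ] + ([ q ≐ z ] + pathDegree (q ∷ ps) z)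
  pathDegree _            z = 0

  countTrue-inPathEdges : ∀ L x → Unique L → countTrue n (inPathEdges L x) ≡ pathDegree L x
  countTrue-inPathEdges []           x _ = countTrue-false n
  countTrue-inPathEdges (p ∷ [])     x _ = countTrue-false n
  countTrue-inPathEdges (p ∷ q ∷ ps) x (p∉ ∷ unique) = begin
    countTrue n (λ y → F y ∨ (S y ∨ R y))              ≡⟨ countTrue-∨ n F∩SR=∅ ⟩
    countTrue n F + countTrue n (λ y → S y ∨ R y)      ≡⟨ cong (countTrue n F +_) (countTrue-∨ n S∩R=∅) ⟩
    countTrue n F + (countTrue n S + countTrue n R)    ≡⟨ cong₂ (λ a b → a + (b + countTrue n R)) countF countS ⟩
    [ p ≐ x ] + ([ q ≐ x ] + countTrue n R)            ≡⟨ cong (λ c → [ p ≐ x ] + ([ q ≐ x ] + c))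
                                                            (countTrue-inPathEdges (q ∷ ps) x unique) ⟩
    [ p ≐ x ] + ([ q ≐ x ] + pathDegree (q ∷ ps) x)    ∎
    where
    open ≡-Reasoning
    F S R : Fin n → Bool
    F y = ⌊ p ≟ x ⌋ ∧ ⌊ q ≟ y ⌋
    S y = ⌊ p ≟ y ⌋ ∧ ⌊ q ≟ x ⌋
    R y = inPathEdges (q ∷ ps) x y
    p∉later : p ∉ q ∷ ps
    p∉later = All¬⇒¬Any p∉
    F∩SR=∅ : ∀ y → F y ≡ true → S y ∨ R y ≡ true → ⊥
    F∩SR=∅ y f sr with ≟∧≟-sound {c = q} f | ∨-true⁻ (S y) sr
    ... | refl , _ | inj₁ s = p∉later (here (sym (proj₂ (≟∧≟-sound s))))
    ... | refl , _ | inj₂ r = p∉later (proj₁ (inPathEdges-∈ (q ∷ ps) r))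
    S∩R=∅ : ∀ y → S y ≡ true → R y ≡ true → ⊥
    S∩R=∅ y s r with ≟∧≟-sound {a = p} s
    ... | refl , _ = p∉later (proj₂ (inPathEdges-∈ (q ∷ ps) r))
    countF : countTrue n F ≡ [ p ≐ x ]
    countF = countTrue-∧-≟ n ⌊ p ≟ x ⌋ q
    countS : countTrue n S ≡ [ q ≐ x ]
    countS = trans (countTrue-cong n (λ y → ∧-comm ⌊ p ≟ y ⌋ _)) (countTrue-∧-≟ n ⌊ q ≟ x ⌋ p)

  degree-removeEdges : ∀ (G : Graph n) {P} x → Linked (Adjacent G) P → Unique P →
                       degree (removeEdges G P) x + pathDegree P x ≡ degree G x
  degree-removeEdges G {P} x linked unique = begin
    degree (removeEdges G P) x + pathDegree P x                 ≡⟨ cong (degree (removeEdges G P) x +_)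
                                                                      (countTrue-inPathEdges P x unique) ⟨
    degree (removeEdges G P) x + countTrue n (inPathEdges P x)  ≡⟨ countTrue-+ n pointwise ⟨
    degree G x                                                  ∎
    where
    open ≡-Reasoning
    pointwise : ∀ y → bit (adj G x y) ≡ bit (adj G x y ∧ not (inPathEdges P x y)) + bit (inPathEdges P x y)
    pointwise y = bit-∧-not (adj G x y) _ (inPathEdges-adjacent G linked)

  removeEdges-⊆ : ∀ (G : Graph n) P {x y} → Adjacent (removeEdges G P) x y →
                  Adjacent G x y × inPathEdges P x y ≢ true
  removeEdges-⊆ G P {x} {y} x~y with adj G x y | inPathEdges P x y
  removeEdges-⊆ G P ()   | false | _
  removeEdges-⊆ G P refl | true  | false = refl , λ ()

  pathDegree-handshake : ∀ h t z →
    [ h ≐ z ] + [ lastOf h t ≐ z ] + pathDegree (h ∷ t) z ≡ 2 * occurrences (h ∷ t) z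
  pathDegree-handshake h []      z = double [ h ≐ z ]
    where
    double : ∀ a → a + a + 0 ≡ 2 * (a + 0)
    double = solve-∀
  pathDegree-handshake h (q ∷ t) z = begin
    [ h ≐ z ] + [ lastOf q t ≐ z ] + ([ h ≐ z ] + ([ q ≐ z ] + pathDegree (q ∷ t) z))
      ≡⟨ rearrange [ h ≐ z ] [ q ≐ z ] [ lastOf q t ≐ z ] (pathDegree (q ∷ t) z) ⟩
    2 * [ h ≐ z ] + ([ q ≐ z ] + [ lastOf q t ≐ z ] + pathDegree (q ∷ t) z)
      ≡⟨ cong (2 * [ h ≐ z ] +_) (pathDegree-handshake q t z) ⟩
    2 * [ h ≐ z ] + 2 * occurrences (q ∷ t) z
      ≡⟨ *-distribˡ-+ 2 [ h ≐ z ] _ ⟨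
    2 * occurrences (h ∷ q ∷ t) z ∎
    where
    open ≡-Reasoning
    rearrange : ∀ a b c d → a + c + (a + (b + d)) ≡ 2 * a + (b + c + d)
    rearrange = solve-∀

  occurrences-∉ : ∀ {z} L → z ∉ L → occurrences L z ≡ 0
  occurrences-∉ []       _  = refl
  occurrences-∉ (p ∷ ps) z∉ = cong₂ _+_ (cong bit (≟-≢ (z∉ ∘ here ∘ sym))) (occurrences-∉ ps (z∉ ∘ there))

  occurrences-∈ : ∀ {z} L → Unique L → z ∈ L → occurrences L z ≡ 1
  occurrences-∈ (p ∷ ps) (p∉ ∷ _) (here refl) =
    cong₂ _+_ (cong bit (≟-refl p)) (occurrences-∉ ps (All¬⇒¬Any p∉))
  occurrences-∈ (p ∷ ps) (p∉ ∷ unique) (there z∈) =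
    cong₂ _+_ (cong bit (≟-≢ λ { refl → All¬⇒¬Any p∉ z∈ })) (occurrences-∈ ps unique z∈)

  pathDegree-inner : ∀ h t {z} → z ≢ h → z ≢ lastOf h t →
                     pathDegree (h ∷ t) z ≡ 2 * occurrences (h ∷ t) z
  pathDegree-inner h t {z} z≢h z≢l =
    trans (sym (cong₂ (λ a b → a + b + pathDegree (h ∷ t) z)
                      (cong bit (≟-≢ (z≢h ∘ sym))) (cong bit (≟-≢ (z≢l ∘ sym)))))
          (pathDegree-handshake h t z)

  pathDegree-head : ∀ h t → Unique (h ∷ t) → h ≢ lastOf h t → pathDegree (h ∷ t) h ≡ 1
  pathDegree-head h t unique h≢l = suc-injective (begin
    suc (pathDegree (h ∷ t) h)                            ≡⟨ cong₂ (λ a b → a + b + pathDegree (h ∷ t) h)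
                                                               (cong bit (≟-refl h)) (cong bit (≟-≢ (h≢l ∘ sym))) ⟨
    [ h ≐ h ] + [ lastOf h t ≐ h ] + pathDegree (h ∷ t) h  ≡⟨ pathDegree-handshake h t h ⟩
    2 * occurrences (h ∷ t) h                             ≡⟨ cong (2 *_) (occurrences-∈ (h ∷ t) unique (here refl)) ⟩
    2                                                     ∎)
    where open ≡-Reasoning

  pathDegree-last : ∀ h t → Unique (h ∷ t) → h ≢ lastOf h t → pathDegree (h ∷ t) (lastOf h t) ≡ 1
  pathDegree-last h t unique h≢l = suc-injective (begin
    suc (pathDegree (h ∷ t) l)            ≡⟨ cong₂ (λ a b → a + b + pathDegree (h ∷ t) l)
                                               (cong bit (≟-≢ h≢l)) (cong bit (≟-refl l)) ⟨
    [ h ≐ l ] + [ l ≐ l ] + pathDegree (h ∷ t) l  ≡⟨ pathDegree-handshake h t l ⟩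
    2 * occurrences (h ∷ t) l             ≡⟨ cong (2 *_) (occurrences-∈ (h ∷ t) unique (lastOf-∈ h t)) ⟩
    2                                     ∎)
    where
    open ≡-Reasoning
    l : Fin n
    l = lastOf h t

module Descent {n : ℕ} (G : Graph n) (f : Fin n → ℕ) where

  Step : Fin n → Fin n → Set
  Step x y = Adjacent G x y × suc (f y) ≡ f x

  step? : ∀ x → Dec (∃ (Step x))
  step? x = any? λ y → (adj G x y Bool.≟ true) ×-dec (suc (f y) Nat.≟ f x)

  -- The vertices after x, with m as fuel.
  descent : ℕ → Fin n → List (Fin n)
  descent zero    x = []
  descent (suc m) x with step? x
  ... | yes (y , _) = y ∷ descent m y
  ... | no  _       = []

  end : ℕ → Fin n → Fin n
  end m x = lastOf x (descent m x)

  descent-linked : ∀ m x → Linked (Adjacent G) (x ∷ descent m x)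
  descent-linked zero    x = [-]
  descent-linked (suc m) x with step? x
  ... | yes (y , x~y , _) = x~y ∷ descent-linked m y
  ... | no  _             = [-]

  descent-below : ∀ m x → All (λ z → f z < f x) (descent m x)
  descent-below zero    x = []
  descent-below (suc m) x with step? x
  ... | yes (y , _ , fy+1≡fx) = fy<fx ∷ All.map (λ fz<fy → <-trans fz<fy fy<fx) (descent-below m y)
    where
    fy<fx : f y < f x
    fy<fx = ≤-reflexive fy+1≡fx
  ... | no  _ = []

  descent-unique : ∀ m x → Unique (x ∷ descent m x)
  descent-unique m x =
    All.map (λ fz<fx x≡z → <-irrefl (cong f (sym x≡z)) fz<fx) (descent-below m x) ∷ tail-unique m x
    where
    tail-unique : ∀ m x → Unique (descent m x)
    tail-unique zero    x = []
    tail-unique (suc m) x with step? x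
    ... | yes (y , _) = descent-unique m y
    ... | no  _       = []

  end-stuck : ∀ m x → f x ≡ m → ∀ y → ¬ Step (end m x) y
  end-stuck zero    x fx≡0 y (_ , fy+1≡fx) with () ← trans fy+1≡fx fx≡0
  end-stuck (suc m) x fx≡m+1 with step? x
  ... | yes (y , _ , fy+1≡fx) = end-stuck m y (suc-injective (trans fy+1≡fx fx≡m+1))
  ... | no  ¬step             = λ y step → ¬step (y , step)

  end≡start : ∀ m x → f (end m x) ≡ f x → end m x ≡ x
  end≡start m x f-end≡fx with descent m x | descent-below m x
  ... | []     | _     = refl
  ... | y ∷ ys | below = ⊥-elim (<-irrefl f-end≡fx (All.lookup below (lastOf-∈ y ys)))

  -- Levels drop by exactly one along the walk, so the vertex one level above the end is its predecessor.
  end-predecessor : ∀ m x {z} → z ∈ x ∷ descent m x → suc (f (end m x)) ≡ f z →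
                    inPathEdges (x ∷ descent m x) (end m x) z ≡ true
  end-predecessor zero    x (here refl) fx+1≡fx = ⊥-elim (1+n≢n fx+1≡fx)
  end-predecessor (suc m) x z∈ f-end+1≡fz with step? x
  end-predecessor (suc m) x (here refl) f-end+1≡fx | yes (y , _ , fy+1≡fx)
    = subst (λ e → inPathEdges (x ∷ y ∷ descent m y) e x ≡ true)
            (sym (end≡start m y (suc-injective (trans f-end+1≡fx (sym fy+1≡fx)))))
            (inPathEdges-back x y (descent m y))
  end-predecessor (suc m) x (there z∈) f-end+1≡fz | yes (y , _)
    = inPathEdges-there x y (descent m y) (end-predecessor m y z∈ f-end+1≡fz)
  end-predecessor (suc m) x (here refl) fx+1≡fx | no _ = ⊥-elim (1+n≢n fx+1≡fx)

even-suc⇒odd : ∀ m → Even (suc m) → Odd m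
even-suc⇒odd (suc zero)    _    = refl
even-suc⇒odd (suc (suc m)) even = even-suc⇒odd m even

[m+2k]%2≡m%2 : ∀ m k → (m + 2 * k) % 2 ≡ m % 2
[m+2k]%2≡m%2 m k = trans (cong (λ j → (m + j) % 2) (*-comm 2 k)) ([m+kn]%n≡m%n m k 2)

removeEdges-bipartition : ∀ {n} (G : Graph n) P {side} →
                          IsBipartition G side → IsBipartition (removeEdges G P) side
removeEdges-bipartition G P bip x y x~y = bip x y (proj₁ (removeEdges-⊆ G P x~y))

locallyIrregular-byParity : ∀ {n} (H : Graph n) (side : Fin n → Bool) (c : Fin n) →
  IsBipartition H side →
  (∀ z → z ≢ c → degree H z % 2 ≡ bit (side z)) →
  (∀ w → Adjacent H c w → degree H c ≢ degree H w) →
  LocallyIrregular H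
locallyIrregular-byParity H side c bip parity at-c x y x~y dx≡dy with x ≟ c | y ≟ c
... | yes refl | _        = at-c y x~y dx≡dy
... | no _     | yes refl = at-c x (trans (adj-sym H c x) x~y) (sym dx≡dy)
... | no x≢c   | no y≢c   =
  bip x y x~y (bit-injective (trans (sym (parity x x≢c)) (trans (cong (_% 2) dx≡dy) (parity y y≢c))))

module _ {n} (G : Graph n) (side : Fin n → Bool) (v : Fin n)
         (bip : IsBipartition G side) (v∈B : side v ≡ true)
         (A-even : ∀ x → side x ≡ false → Even (degree G x))
         (B-odd : ∀ x → side x ≡ true → x ≢ v → Odd (degree G x)) where

  private
    D : Fin n → ℕ
    D = degree G

  degree-parity : ∀ z → z ≢ v → D z % 2 ≡ bit (side z)
  degree-parity z z≢v with side z in side-z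
  ... | false = A-even z side-z
  ... | true  = B-odd z side-z z≢v

  Twin : Fin n → Set
  Twin p = Adjacent G v p × D p ≡ D v

  irregular-without-twin : ¬ ∃ Twin → LocallyIrregular (removeEdges G (v ∷ []))
  irregular-without-twin no-twin =
    locallyIrregular-byParity G₀ side v (removeEdges-bipartition G (v ∷ []) bip) parity at-v
    where
    G₀ : Graph n
    G₀ = removeEdges G (v ∷ [])
    unchanged : ∀ z → degree G₀ z ≡ D z
    unchanged z = trans (sym (+-identityʳ _)) (degree-removeEdges G {v ∷ []} z [-] ([] ∷ []))
    parity : ∀ z → z ≢ v → degree G₀ z % 2 ≡ bit (side z)
    parity z z≢v = trans (cong (_% 2) (unchanged z)) (degree-parity z z≢v)
    at-v : ∀ w → Adjacent G₀ v w → degree G₀ v ≢ degree G₀ w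
    at-v w v~w dv≡dw =
      no-twin (w , proj₁ (removeEdges-⊆ G (v ∷ []) v~w) , trans (sym (unchanged w)) (trans (sym dv≡dw) (unchanged v)))

  module WithTwin (p : Fin n) (v~p : Adjacent G v p) (Dp≡Dv : D p ≡ D v) where
    open Descent G D

    walk : List (Fin n)
    walk = p ∷ descent (D p) p

    P : List (Fin n)
    P = v ∷ walk

    e : Fin n
    e = end (D p) p

    G′ : Graph n
    G′ = removeEdges G P

    d′ : Fin n → ℕ
    d′ = degree G′

    v∉walk : v ∉ walk
    v∉walk (here refl) with () ← trans (sym v~p) (irrefl G v)
    v∉walk (there v∈)  = <-irrefl (sym Dp≡Dv) (All.lookup (descent-below (D p) p) v∈)

    e≢v : e ≢ v
    e≢v refl = v∉walk (lastOf-∈ p (descent (D p) p))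

    P-linked : Linked (Adjacent G) P
    P-linked = v~p ∷ descent-linked (D p) p

    P-unique : Unique P
    P-unique = ¬Any⇒All¬ walk v∉walk ∷ descent-unique (D p) p

    P-isPath : IsPathFrom G v P
    P-isPath = refl , P-linked , P-unique

    d′+pathDegree : ∀ z → d′ z + pathDegree P z ≡ D z
    d′+pathDegree z = degree-removeEdges G z P-linked P-unique

    d′-dropsBy : ∀ {z k} → pathDegree P z ≡ k → k + d′ z ≡ D z
    d′-dropsBy {z} {k} refl = trans (+-comm k (d′ z)) (d′+pathDegree z)

    d′-start : suc (d′ v) ≡ D v
    d′-start = d′-dropsBy (pathDegree-head v walk P-unique (e≢v ∘ sym))

    d′-end : suc (d′ e) ≡ D e
    d′-end = d′-dropsBy (pathDegree-last v walk P-unique (e≢v ∘ sym))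

    d′-inner : ∀ {z} → z ∈ walk → z ≢ e → suc (suc (d′ z)) ≡ D z
    d′-inner {z} z∈ z≢e = d′-dropsBy (trans (pathDegree-inner v walk z≢v z≢e)
                                            (cong (2 *_) (occurrences-∈ P P-unique (there z∈))))
      where
      z≢v : z ≢ v
      z≢v refl = v∉walk z∈

    d′-outside : ∀ {z} → z ∉ P → d′ z ≡ D z
    d′-outside {z} z∉ = d′-dropsBy (trans (pathDegree-inner v walk (z∉ ∘ here) (z∉ ∘ there ∘ e∈))
                                         (cong (2 *_) (occurrences-∉ P z∉)))
      where
      e∈ : z ≡ e → z ∈ walk
      e∈ refl = lastOf-∈ p (descent (D p) p)

    parity : ∀ z → z ≢ e → d′ z % 2 ≡ bit (side z)
    parity z z≢e with z ≟ v
    ... | no z≢v = begin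
      d′ z % 2                                ≡⟨ [m+2k]%2≡m%2 (d′ z) (occurrences P z) ⟨
      (d′ z + 2 * occurrences P z) % 2         ≡⟨ cong (λ k → (d′ z + k) % 2) (pathDegree-inner v walk z≢v z≢e) ⟨
      (d′ z + pathDegree P z) % 2             ≡⟨ cong (_% 2) (d′+pathDegree z) ⟩
      D z % 2                                 ≡⟨ degree-parity z z≢v ⟩
      bit (side z)                            ∎
      where open ≡-Reasoning
    ... | yes refl = trans (even-suc⇒odd (d′ v) (subst Even (trans Dp≡Dv (sym d′-start)) (A-even p p∈A)))
                           (cong bit (sym v∈B))
      where
      p∈A : side p ≡ false
      p∈A with side p in side-p
      ... | false = refl
      ... | true  = ⊥-elim (bip v p v~p (trans v∈B (sym side-p)))

    end-irregular : ∀ w → Adjacent G′ e w → d′ e ≢ d′ w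
    end-irregular w e~w d′e≡d′w with removeEdges-⊆ G P e~w | w ≟ v | Any.any? (w ≟_) walk
    ... | _ , not-on-P | yes refl | _ = not-on-P
      (subst (λ x → inPathEdges P x v ≡ true) (sym (end≡start (D p) p De≡Dp)) (inPathEdges-back v p (descent (D p) p)))
      where
      De≡Dp : D e ≡ D p
      De≡Dp = trans (sym d′-end) (trans (cong suc d′e≡d′w) (trans d′-start (sym Dp≡Dv)))
    ... | e~Gw , _ | no w≢v | no w∉walk = end-stuck (D p) p refl w (e~Gw , Dw+1≡De)
      where
      Dw+1≡De : suc (D w) ≡ D e
      Dw+1≡De = trans (cong suc (trans (sym (d′-outside λ { (here refl) → w≢v refl ; (there w∈) → w∉walk w∈ }))
                                       (sym d′e≡d′w)))
                      d′-end
    ... | _ , not-on-P | no _ | yes w∈walk = not-on-P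
      (inPathEdges-there v p (descent (D p) p) (end-predecessor (D p) p w∈walk De+1≡Dw))
      where
      w≢e : w ≢ e
      w≢e refl with () ← trans (sym (proj₁ (removeEdges-⊆ G P e~w))) (irrefl G w)
      De+1≡Dw : suc (D e) ≡ D w
      De+1≡Dw = trans (cong suc (sym d′-end)) (trans (cong (λ k → suc (suc k)) d′e≡d′w) (d′-inner w∈walk w≢e))

    irregular : LocallyIrregular G′
    irregular = locallyIrregular-byParity G′ side e (removeEdges-bipartition G P bip) parity end-irregular

lemma14 : ∀ {n} (G : Graph n) (side : Fin n → Bool) (v : Fin n) →
    IsBipartition G side →
    side v ≡ true →
    (∀ x → side x ≡ false → Even (degree G x)) →
    (∀ x → side x ≡ true → x ≢ v → Odd (degree G x)) →
    Σ (List (Fin n)) (λ P → IsPathFrom G v P × LocallyIrregular (removeEdges G P))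
lemma14 G side v bip v∈B A-even B-odd
  with any? (λ p → (adj G v p Bool.≟ true) ×-dec (degree G p Nat.≟ degree G v))
... | yes (p , v~p , Dp≡Dv) = P , P-isPath , irregular
  where open WithTwin G side v bip v∈B A-even B-odd p v~p Dp≡Dv
... | no no-twin = v ∷ [] , (refl , [-] , [] ∷ []) , irregular-without-twin G side v bip v∈B A-even B-odd no-twin
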